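{- Let $\Sigma$ be a signed simple graph in which every edge is negative, let $\gamma$ be a proper $n$-edge coloring of $\Sigma$, and let $a,b\in M_n$ with $a$ absent and $b$ present at a vertex $v_0$. Then the $a/b$-chain $K_{a,b}(v_0,v_m)$ at $v_0$ is a path (it repeats no vertex).
   Context: A signed graph is $\Sigma=(\Gamma,\sigma)$ with $\Gamma$ a finite simple graph and $\sigma:E(\Gamma)\to\{+,-\}$. An incidence is a pair $(v,e)$ with $v$ an endpoint of $e$. For $n\ge1$, $M_n=\{0,\pm1,\ldots,\pm k\}$ if $n=2k+1$ and $M_n=\{\pm1,\ldots,\pm k\}$ if $n=2k$. An $n$-edge coloring is a map $\gamma$ from incidences to $M_n$ with $\gamma(v,e)=-\sigma(e)\gamma(w,e)$ for each edge $e$ with endpoints $v,w$ (so both incidences of an edge have the same magnitude, called the magnitude of the edge); it is proper if $\gamma(v,e)\neq\gamma(v,f)$ for distinct edges $e,f$ at a common vertex $v$. A color $c$ is present at $v$ if $\gamma(v,e)=c$ for some edge $e$ at $v$, absent otherwise. A trail $(v_0,\ldots,v_m)$ is a sequence of vertices with consecutive ones adjacent and no edge repeated (vertices may repeat). For a trail, $t_i$ denotes the number of positive edges among $v_0v_1,\ldots,v_{i-1}v_i$. If $a$ is absent and $b$ present at $v_0$, the $a/b$-chain at $v_0$, written $K_{a,b}(v_0,v_m)$, is the maximal trail $(v_0,\ldots,v_m)$ starting at $v_0$ such that (1) the edge magnitudes alternate between $|b|$ and $|a|$ along it, starting with $|b|$, and (2) $\{\gamma(v_i,v_{i-1}v_i),\gamma(v_i,v_iv_{i+1})\}=\{(-1)^{t_i}a,(-1)^{t_i}b\}$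 for all $0<i<m$. -}

module Defs where

open import Data.Nat using (ℕ; zero; suc; _+_; _*_; _≤_; _<_)
open import Data.Integer using (ℤ; -_; ∣_∣)
open import Data.Product using (Σ; ∃; _×_; _,_)
open import Data.Sum using (_⊎_)
open import Data.Fin using (Fin)
open import Relation.Nullary using (¬_)
open import Relation.Binary.PropositionalEquality using (_≡_; _≢_)
open import Level using (0ℓ)

record SimpleGraph (N : ℕ) : Set₁ where
  field
    Adj    : Fin N → Fin N → Set
    sym    : ∀ {v w} → Adj v w → Adj w v
    irrefl : ∀ {v} → ¬ Adj v v
open SimpleGraph public

data Sign : Set where
  pos neg : Sign

_·ˢ_ : Sign → ℤ → ℤ
pos ·ˢ c = c
neg ·ˢ c = - c

-- A signed graph (Γ, σ).  The signature is given on ordered pairs and must be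
-- symmetric on edges, so that it is a function of the (unordered) edge.
record SignedGraph (N : ℕ) : Set₁ where
  field
    graph   : SimpleGraph N
    σ       : Fin N → Fin N → Sign
    σ-sym   : ∀ {v w} → Adj graph v w → σ v w ≡ σ w v
open SignedGraph public

AllNegative : ∀ {N} → SignedGraph N → Set
AllNegative Σ' = ∀ v w → Adj (graph Σ') v w → σ Σ' v w ≡ neg

-- The colour set M_n : {0,±1,…,±k} if n = 2k+1, {±1,…,±k} if n = 2k.
InM : ℕ → ℤ → Set
InM n c = (∃ λ k → n ≡ suc (2 * k) × ∣ c ∣ ≤ k)
        ⊎ (∃ λ k → n ≡ 2 * k × 1 ≤ ∣ c ∣ × ∣ c ∣ ≤ k)

-- An edge colouring: γ v w is the colour of the incidence (v, vw).
-- (Values on non-adjacent pairs are irrelevant and never constrained.)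
Coloring : ℕ → Set
Coloring N = Fin N → Fin N → ℤ

IsEdgeColoring : ∀ {N} → SignedGraph N → ℕ → Coloring N → Set
IsEdgeColoring Σ' n γ =
  (∀ v w → Adj (graph Σ') v w → InM n (γ v w)) ×
  (∀ v w → Adj (graph Σ') v w → γ v w ≡ - (σ Σ' v w ·ˢ γ w v))

IsProper : ∀ {N} → SignedGraph N → Coloring N → Set
IsProper Σ' γ = ∀ v w w' → Adj (graph Σ') v w → Adj (graph Σ') v w' →
                w ≢ w' → γ v w ≢ γ v w'

Present : ∀ {N} → SignedGraph N → Coloring N → Fin N → ℤ → Set
Present Σ' γ v c = ∃ λ w → Adj (graph Σ') v w × γ v w ≡ c

Absent : ∀ {N} → SignedGraph N → Coloring N → Fin N → ℤ → Set
Absent Σ' γ v c = ¬ Present Σ' γ v c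

-- A vertex sequence (v 0, …, v m) is represented by v : ℕ → Fin N together
-- with its length m (only the values v 0 … v m matter).
SameEdge : ∀ {N} → (ℕ → Fin N) → ℕ → ℕ → Set
SameEdge v i j = (v i ≡ v j × v (suc i) ≡ v (suc j))
               ⊎ (v i ≡ v (suc j) × v (suc i) ≡ v j)

IsTrail : ∀ {N} → SignedGraph N → ℕ → (ℕ → Fin N) → Set
IsTrail Σ' m v =
  (∀ i → i < m → Adj (graph Σ') (v i) (v (suc i))) ×
  (∀ i j → i < m → j < m → i ≢ j → ¬ SameEdge v i j)

posCount : ∀ {N} → SignedGraph N → (ℕ → Fin N) → ℕ → ℕ
posCount Σ' v zero = zero
posCount Σ' v (suc i) with σ Σ' (v i) (v (suc i))
... | pos = suc (posCount Σ' v i)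
... | neg = posCount Σ' v i

negPow : ℕ → ℤ → ℤ
negPow zero c = c
negPow (suc t) c = - negPow t c

PairEq : ℤ → ℤ → ℤ → ℤ → Set
PairEq x y p q = (x ≡ p × y ≡ q) ⊎ (x ≡ q × y ≡ p)

-- magnitude required for the (i+1)-st edge v i v (i+1): |b| for i even, |a| for i odd
-- (so the magnitudes alternate |b|, |a|, |b|, … starting with |b|)
EdgeMag : ℕ → ℤ → ℤ → ℕ → Set
EdgeMag i a b mag = (∃ λ k → i ≡ 2 * k × mag ≡ ∣ b ∣)
                  ⊎ (∃ λ k → i ≡ suc (2 * k) × mag ≡ ∣ a ∣)

IsABTrail : ∀ {N} → SignedGraph N → Coloring N → ℤ → ℤ → Fin N →
            ℕ → (ℕ → Fin N) → Set
IsABTrail Σ' γ a b v0 m v =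
  v 0 ≡ v0 ×
  IsTrail Σ' m v ×
  (∀ i → i < m → EdgeMag i a b ∣ γ (v i) (v (suc i)) ∣) ×
  (∀ j → suc j < m →
     PairEq (γ (v (suc j)) (v j)) (γ (v (suc j)) (v (suc (suc j))))
            (negPow (posCount Σ' v (suc j)) a) (negPow (posCount Σ' v (suc j)) b))

IsABChain : ∀ {N : ℕ} → SignedGraph N → Coloring N → ℤ → ℤ → Fin N →
            ℕ → (ℕ → Fin N) → Set
IsABChain {N} Σ' γ a b v0 m v =
  IsABTrail Σ' γ a b v0 m v ×
  (∀ m' (v' : ℕ → Fin N) → m < m' → (∀ i → i ≤ m → v' i ≡ v i) →
     ¬ IsABTrail Σ' γ a b v0 m' v')

IsPathSeq : ∀ {N} → ℕ → (ℕ → Fin N) → Set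
IsPathSeq m v = ∀ i j → i ≤ m → j ≤ m → v i ≡ v j → i ≡ j

-- In an all-negative signed graph the two incidences of an edge carry the same
-- colour and every trail has t_i = 0, so an a/b-chain leaves each interior vertex
-- along exactly the edges coloured a and b there; by properness these are the
-- only such edges. Revisiting an interior vertex would therefore reuse one of
-- them, and revisiting v₀ would reuse its unique b-edge, since a is absent there.
module Submission where

open import Defs
open import Data.Nat using (ℕ; zero; suc; _≤_; _<_; s≤s; z≤n; _≟_)
open import Data.Nat.Properties using (<-cmp; ≤-trans; n≤1+n; n<1+n; <⇒≤; <⇒≢; ≤-<-trans)
open import Data.Integer using (ℤ; -_)
open import Data.Integer.Properties using (neg-involutive)
open import Data.Fin using (Fin)
open import Data.Fin.Properties using () renaming (_≟_ to _≟ᶠ_)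
open import Data.Product using (_,_; proj₁; proj₂)
open import Data.Sum using (_⊎_; inj₁; inj₂)
open import Data.Empty using (⊥; ⊥-elim)
open import Relation.Nullary using (yes; no; ¬_)
open import Relation.Binary using (tri<; tri≈; tri>)
open import Relation.Binary.PropositionalEquality
  using (_≡_; _≢_; refl; trans; subst) renaming (sym to ≡-sym)

OneOf : ℤ → ℤ → ℤ → Set
OneOf a b x = x ≡ a ⊎ x ≡ b

pairEq-oneOfˡ : ∀ {x y a b} → PairEq x y a b → OneOf a b x
pairEq-oneOfˡ (inj₁ (x≡a , _)) = inj₁ x≡a
pairEq-oneOfˡ (inj₂ (x≡b , _)) = inj₂ x≡b

pairEq-oneOfʳ : ∀ {x y a b} → PairEq x y a b → OneOf a b y
pairEq-oneOfʳ (inj₁ (_ , y≡b)) = inj₂ y≡b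
pairEq-oneOfʳ (inj₂ (_ , y≡a)) = inj₁ y≡a

module _ {N : ℕ} (Σ' : SignedGraph N) where

  private
    G = graph Σ'

  colour-sym-negative : ∀ (γ : Coloring N) {x y} → σ Σ' x y ≡ neg →
    γ x y ≡ - (σ Σ' x y ·ˢ γ y x) → γ x y ≡ γ y x
  colour-sym-negative γ {x} {y} σ≡neg γxy rewrite σ≡neg = trans γxy (neg-involutive (γ y x))

  posCount-allNegative : AllNegative Σ' → ∀ (v : ℕ → Fin N) k →
    (∀ i → i < k → Adj G (v i) (v (suc i))) → posCount Σ' v k ≡ 0
  posCount-allNegative allNeg v zero adj = refl
  posCount-allNegative allNeg v (suc k) adj
    with σ Σ' (v k) (v (suc k)) | allNeg (v k) (v (suc k)) (adj k (n<1+n k))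
  ... | neg | _ = posCount-allNegative allNeg v k (λ i i<k → adj i (≤-trans i<k (n≤1+n k)))

  proper-injective : ∀ {γ} → IsProper Σ' γ → ∀ {u w w'} →
    Adj G u w → Adj G u w' → γ u w ≡ γ u w' → w ≡ w'
  proper-injective prop {u} {w} {w'} uw uw' γ≡ with w ≟ᶠ w'
  ... | yes w≡w' = w≡w'
  ... | no w≢w' = ⊥-elim (prop u w w' uw uw' w≢w' γ≡)

  proper-pairEq-neighbour : ∀ {γ a b} → IsProper Σ' γ → ∀ {u p s w} →
    PairEq (γ u p) (γ u s) a b → Adj G u p → Adj G u s → Adj G u w →
    OneOf a b (γ u w) → w ≡ p ⊎ w ≡ s
  proper-pairEq-neighbour prop (inj₁ (p≡a , _)) up us uw (inj₁ w≡a) =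
    inj₁ (proper-injective prop uw up (trans w≡a (≡-sym p≡a)))
  proper-pairEq-neighbour prop (inj₁ (_ , s≡b)) up us uw (inj₂ w≡b) =
    inj₂ (proper-injective prop uw us (trans w≡b (≡-sym s≡b)))
  proper-pairEq-neighbour prop (inj₂ (_ , s≡a)) up us uw (inj₁ w≡a) =
    inj₂ (proper-injective prop uw us (trans w≡a (≡-sym s≡a)))
  proper-pairEq-neighbour prop (inj₂ (p≡b , _)) up us uw (inj₂ w≡b) =
    inj₁ (proper-injective prop uw up (trans w≡b (≡-sym p≡b)))

module NegativeABTrail {N : ℕ} (Σ' : SignedGraph N) (γ : Coloring N) (a b : ℤ)
    (m : ℕ) (v : ℕ → Fin N)
    (allNeg : AllNegative Σ')
    (γ-sym : ∀ x y → Adj (graph Σ') x y → γ x y ≡ γ y x)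
    (prop : IsProper Σ' γ)
    (a-absent : Absent Σ' γ (v 0) a)
    (trail : IsABTrail Σ' γ a b (v 0) m v) where

  private
    G = graph Σ'

  adj : ∀ i → i < m → Adj G (v i) (v (suc i))
  adj = proj₁ (proj₁ (proj₂ trail))

  edges-distinct : ∀ i j → i < m → j < m → i ≢ j → ¬ SameEdge v i j
  edges-distinct = proj₂ (proj₁ (proj₂ trail))

  interior-colours : ∀ j → suc j < m →
    PairEq (γ (v (suc j)) (v j)) (γ (v (suc j)) (v (suc (suc j)))) a b
  interior-colours j j+1<m =
    subst (λ t → PairEq (γ (v (suc j)) (v j)) (γ (v (suc j)) (v (suc (suc j)))) (negPow t a) (negPow t b))
      (posCount-allNegative Σ' allNeg v (suc j) (λ i i≤j → adj i (≤-trans i≤j (<⇒≤ j+1<m))))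
      (proj₂ (proj₂ (proj₂ trail)) j j+1<m)

  incoming-colour : ∀ j → suc j < m → OneOf a b (γ (v (suc (suc j))) (v (suc j)))
  incoming-colour j j+1<m =
    subst (OneOf a b) (γ-sym _ _ (adj (suc j) j+1<m)) (pairEq-oneOfʳ (interior-colours j j+1<m))

  b-at-start : ∀ {w} → Adj G (v 0) w → OneOf a b (γ (v 0) w) → γ (v 0) w ≡ b
  b-at-start {w} v0w (inj₁ ≡a) = ⊥-elim (a-absent (w , v0w , ≡a))
  b-at-start v0w (inj₂ ≡b) = ≡b

  first-colour : 1 < m → γ (v 0) (v 1) ≡ b
  first-colour 1<m = b-at-start v0v1
    (subst (OneOf a b) (≡-sym (γ-sym _ _ v0v1)) (pairEq-oneOfˡ (interior-colours 0 1<m)))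
    where
      v0v1 : Adj G (v 0) (v 1)
      v0v1 = adj 0 (<⇒≤ 1<m)

  start-revisit : ∀ j → 0 < j → j ≤ m → v 0 ≢ v j
  start-revisit (suc zero) _ 1≤m v0≡v1 = irrefl G (subst (Adj G (v 0)) (≡-sym v0≡v1) (adj 0 1≤m))
  start-revisit (suc (suc k)) _ k+2≤m v0≡v =
    edges-distinct 0 (suc k) (<⇒≤ 1<m) k+2≤m (λ ()) (inj₂ (v0≡v , v1≡vk+1))
    where
      1<m : 1 < m
      1<m = ≤-trans (s≤s (s≤s z≤n)) k+2≤m
      v0vk+1 : Adj G (v 0) (v (suc k))
      v0vk+1 = subst (λ u → Adj G u (v (suc k))) (≡-sym v0≡v) (sym G (adj (suc k) k+2≤m))
      colour : OneOf a b (γ (v 0) (v (suc k)))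
      colour = subst (λ u → OneOf a b (γ u (v (suc k)))) (≡-sym v0≡v) (incoming-colour k k+2≤m)
      v1≡vk+1 : v 1 ≡ v (suc k)
      v1≡vk+1 = proper-injective Σ' prop (adj 0 (<⇒≤ 1<m)) v0vk+1
        (trans (first-colour 1<m) (≡-sym (b-at-start v0vk+1 colour)))

  -- The edge entering the second visit is an a- or b-edge at v (suc i), so it
  -- is one of the two trail edges there, entered from the other side.
  interior-revisit : ∀ i j → suc i < suc j → suc j ≤ m → v (suc i) ≢ v (suc j)
  interior-revisit i (suc k) (s≤s i<k+1) k+2≤m vi+1≡v =
    reused-edge (proper-pairEq-neighbour Σ' prop (interior-colours i i+1<m)
                  (sym G (adj i (<⇒≤ i+1<m))) (adj (suc i) i+1<m) vi+1vk+1 colour)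
    where
      i+1<m : suc i < m
      i+1<m = ≤-<-trans i<k+1 k+2≤m
      vi+1vk+1 : Adj G (v (suc i)) (v (suc k))
      vi+1vk+1 = subst (λ u → Adj G u (v (suc k))) (≡-sym vi+1≡v) (sym G (adj (suc k) k+2≤m))
      colour : OneOf a b (γ (v (suc i)) (v (suc k)))
      colour = subst (λ u → OneOf a b (γ u (v (suc k)))) (≡-sym vi+1≡v) (incoming-colour k k+2≤m)
      reused-edge : v (suc k) ≡ v i ⊎ v (suc k) ≡ v (suc (suc i)) → ⊥
      reused-edge (inj₁ vk+1≡vi) =
        edges-distinct i (suc k) (<⇒≤ i+1<m) k+2≤m (<⇒≢ i<k+1) (inj₁ (≡-sym vk+1≡vi , vi+1≡v))
      reused-edge (inj₂ vk+1≡vi+2) with suc i ≟ suc k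
      ... | yes refl = irrefl G (subst (Adj G (v (suc i))) (≡-sym vi+1≡v) (adj (suc i) k+2≤m))
      ... | no i≢k = edges-distinct (suc i) (suc k) i+1<m k+2≤m i≢k (inj₂ (vi+1≡v , ≡-sym vk+1≡vi+2))

  no-revisit : ∀ i j → i < j → j ≤ m → v i ≢ v j
  no-revisit zero j = start-revisit j
  no-revisit (suc i) (suc j) = interior-revisit i j

  is-path : IsPathSeq m v
  is-path i j i≤m j≤m vi≡vj with <-cmp i j
  ... | tri< i<j _ _ = ⊥-elim (no-revisit i j i<j j≤m vi≡vj)
  ... | tri≈ _ i≡j _ = i≡j
  ... | tri> _ _ j<i = ⊥-elim (no-revisit j i j<i i≤m (≡-sym vi≡vj))

mainTheorem11 : ∀ {N : ℕ} (Σ' : SignedGraph N) (n : ℕ) (γ : Coloring N)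
    (a b : ℤ) (v0 : Fin N) (m : ℕ) (v : ℕ → Fin N) →
    1 ≤ n →
    AllNegative Σ' →
    IsEdgeColoring Σ' n γ →
    IsProper Σ' γ →
    InM n a → InM n b →
    Absent Σ' γ v0 a →
    Present Σ' γ v0 b →
    IsABChain Σ' γ a b v0 m v →
    IsPathSeq m v
mainTheorem11 Σ' n γ a b v0 m v _ allNeg (_ , conj) prop _ _ a-absent _ (trail , _) =
  NegativeABTrail.is-path Σ' γ a b m v allNeg γ-sym prop a-absent-at-start trail-from-start
  where
    v0≡ : v 0 ≡ v0
    v0≡ = proj₁ trail
    γ-sym : ∀ x y → Adj (graph Σ') x y → γ x y ≡ γ y x
    γ-sym x y xy = colour-sym-negative Σ' γ (allNeg x y xy) (conj x y xy)
    a-absent-at-start : Absent Σ' γ (v 0) a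
    a-absent-at-start = subst (λ u → Absent Σ' γ u a) (≡-sym v0≡) a-absent
    trail-from-start : IsABTrail Σ' γ a b (v 0) m v
    trail-from-start = subst (λ u → IsABTrail Σ' γ a b u m v) (≡-sym v0≡) trail
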